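{- Let $G$ be a simple graph and let $D$ be a divisor on $G$. For every vertex $P\in V(G)$ there exists $E\in\operatorname{Proof}(D)$ such that $E(P)=0$.
   Context: A graph is a finite connected multigraph with no loop edges; a simple graph is a graph with no multiple edges and more than one vertex. A divisor on $G$ is a formal integer combination $D=\sum_{Q\in V(G)}D(Q)\,Q$; $\deg D=\sum_Q D(Q)$; effective means all coefficients $\ge0$. For $f:V(G)\to\mathbb{Z}$, $\Delta f$ is the divisor with $\Delta f(Q)=\sum_{e=QR\in E(G)}(f(Q)-f(R))$. $|D|=\{E\ge 0:E-D=\Delta f\text{ for some }f\}$. The rank $r(D)$ is $-1$ if $|D|=\emptyset$, and otherwise the largest $k\ge 0$ such that $|D-E|\neq\emptyset$ for every effective divisor $E$ of degree $k$. $\operatorname{Proof}(D)$ is the set of effective divisors $E$ of degree $r(D)+1$ with $|D-E|=\emptyset$. -}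

module Defs where

open import Data.Nat using (ℕ; zero; suc; _≥_)
open import Data.Integer using (ℤ; +_; -[1+_]; _+_; _-_; _≤_; -_)
open import Data.Fin using (Fin; zero; suc)
open import Data.Bool using (Bool; true; false; if_then_else_)
open import Data.Product using (Σ; ∃; _×_; _,_)
open import Data.Sum using (_⊎_)
open import Relation.Binary.PropositionalEquality using (_≡_)
open import Relation.Nullary using (¬_)

∑ : {n : ℕ} → (Fin n → ℤ) → ℤ
∑ {zero}  f = + 0
∑ {suc n} f = f zero + ∑ (λ i → f (suc i))

data Reachable {n : ℕ} (adj : Fin n → Fin n → Bool) : Fin n → Fin n → Set where
  here : ∀ {u} → Reachable adj u u
  step : ∀ {u w v} → adj u w ≡ true → Reachable adj w v → Reachable adj u v

record SimpleGraph : Set where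
  field
    n         : ℕ
    adj       : Fin n → Fin n → Bool
    sym       : ∀ u v → adj u v ≡ adj v u
    loopless  : ∀ u → adj u u ≡ false
    connected : ∀ u v → Reachable adj u v
    twoVerts  : n ≥ 2

module _ (G : SimpleGraph) where
  open SimpleGraph G

  Divisor : Set
  Divisor = Fin n → ℤ

  deg : Divisor → ℤ
  deg D = ∑ D

  Effective : Divisor → Set
  Effective D = ∀ Q → + 0 ≤ D Q

  _⊖_ : Divisor → Divisor → Divisor
  (D ⊖ E) Q = D Q - E Q

  Δ : (Fin n → ℤ) → Divisor
  Δ f Q = ∑ (λ R → if adj Q R then f Q - f R else + 0)

  InLinSys : Divisor → Divisor → Set
  InLinSys D E = Effective E × ∃ λ (f : Fin n → ℤ) → ∀ Q → E Q - D Q ≡ Δ f Q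

  LinSysNonempty : Divisor → Set
  LinSysNonempty D = ∃ λ (E : Divisor) → InLinSys D E

  RankAtLeast : Divisor → ℕ → Set
  RankAtLeast D k = ∀ (E : Divisor) → Effective E → deg E ≡ + k → LinSysNonempty (D ⊖ E)

  IsRank : Divisor → ℤ → Set
  IsRank D r =
    (r ≡ -[1+ 0 ] × ¬ LinSysNonempty D)
    ⊎ (LinSysNonempty D × Σ ℕ λ k → r ≡ + k × RankAtLeast D k
         × (∀ (k' : ℕ) → k' Data.Nat.> k → ¬ RankAtLeast D k'))

  InProof : Divisor → Divisor → Set
  InProof D E = Σ ℤ λ r → IsRank D r × Effective E × deg E ≡ r + + 1
                  × ¬ LinSysNonempty (D ⊖ E)

module Submission where

-- If |D| = ∅ the zero divisor works. Otherwise D has a rank r: potentials of solutions of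
-- D + Δ f ≥ 0 are bounded once normalised at P, and there are finitely many effective divisors
-- of each degree, so every condition involved is decidable. Suppose every effective E of
-- degree r + 1 with E(P) = 0 had |D − E| ≠ ∅, and let E of degree r + 1 have E(P) > 0 and
-- |D − E| = ∅. For D′ = D − (E − P) we have |D′| ≠ ∅ by the rank and |D′ − P| = ∅. The
-- P-reduced divisor of |D′| (no set avoiding P can fire legally) vanishes at P and at some
-- neighbour Q, and then |D′ − Q| = ∅; so moving one chip of E from P to Q keeps |D − E| = ∅
-- and lowers E(P).
-- By induction r(D) ≥ r + 1, a contradiction.

open import Defs
open import Data.Integer using (+_)
open import Data.Fin using (Fin)
open import Data.Product using (∃; _×_)
open import Relation.Binary.PropositionalEquality using (_≡_)

open import Data.Nat as ℕ using (ℕ; zero; suc; z≤n; s≤s)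
import Data.Nat.Properties as ℕP
open import Data.Integer as ℤ using (ℤ; -[1+_]; _+_; _-_; -_; _*_; _≤_; _<_; ∣_∣; +≤+)
import Data.Integer.Properties as ℤP
open import Data.Integer.Tactic.RingSolver using (solve-∀)
open import Data.Fin as F using (zero; suc; toℕ; fromℕ<)
import Data.Fin.Properties as FP
open import Data.Fin.Subset.Properties using (anySubset?)
open import Data.Bool using (Bool; true; false; if_then_else_; not; _∧_)
import Data.Bool.Properties as BP
open import Data.Product using (_,_; proj₁; proj₂)
open import Data.Sum using (inj₁; inj₂)
open import Data.Empty using (⊥-elim)
open import Data.Unit using (⊤; tt)
open import Data.Vec using (Vec; []; _∷_; lookup; tabulate)
import Data.Vec.Properties as VP
open import Function using (_∘_)
open import Relation.Nullary using (¬_; Dec; yes; no; does)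
open import Relation.Nullary.Decidable
  using (_×-dec_; _→-dec_; ¬?; map′; decidable-stable; dec-true; dec-false)
open import Relation.Unary using (Decidable)
open import Relation.Binary.PropositionalEquality
  using (refl; sym; trans; cong; cong₂; subst; _≗_; module ≡-Reasoning)
import Algebra.Properties.Semiring.Sum ℤP.+-*-semiring as Sum

𝟙 : Bool → ℤ
𝟙 true  = + 1
𝟙 false = + 0

𝟙-nonNeg : ∀ b → + 0 ≤ 𝟙 b
𝟙-nonNeg true  = +≤+ z≤n
𝟙-nonNeg false = +≤+ z≤n

𝟙+𝟙-not : ∀ b → 𝟙 b + 𝟙 (not b) ≡ + 1
𝟙+𝟙-not true  = refl
𝟙+𝟙-not false = refl

i≡-i⇒i≡0 : ∀ {i : ℤ} → i ≡ - i → i ≡ + 0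
i≡-i⇒i≡0 {+ zero}  _  = refl
i≡-i⇒i≡0 {+ suc _} ()
i≡-i⇒i≡0 { -[1+ _ ]} ()

i-j≡-[j-i] : ∀ i j → i - j ≡ - (j - i)
i-j≡-[j-i] = solve-∀

[i+j]-[k+l]≡[i-k]+[j-l] : ∀ i j k l → (i + j) - (k + l) ≡ (i - k) + (j - l)
[i+j]-[k+l]≡[i-k]+[j-l] = solve-∀

-i--j≡-[i-j] : ∀ i j → - i - - j ≡ - (i - j)
-i--j≡-[i-j] = solve-∀

[i+j]-i≡j : ∀ i j → (i + j) - i ≡ j
[i+j]-i≡j = solve-∀

i≡j+[i-j] : ∀ i j → i ≡ j + (i - j)
i≡j+[i-j] = solve-∀

0≤i<1⇒i≡0 : ∀ {i : ℤ} → + 0 ≤ i → ¬ (+ 1 ≤ i) → i ≡ + 0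
0≤i<1⇒i≡0 {+ zero}  _ _  = refl
0≤i<1⇒i≡0 {+ suc _} _ 1≰i = ⊥-elim (1≰i (+≤+ (s≤s z≤n)))

-- Sums over Fin n

∑≡sum : ∀ {n} (f : Fin n → ℤ) → ∑ f ≡ Sum.sum f
∑≡sum {zero}  f = refl
∑≡sum {suc n} f = cong (_+_ (f zero)) (∑≡sum (f ∘ suc))

∑-cong : ∀ {n} {f g : Fin n → ℤ} → f ≗ g → ∑ f ≡ ∑ g
∑-cong {f = f} {g} f≗g = trans (∑≡sum f) (trans (Sum.sum-cong-≗ f≗g) (sym (∑≡sum g)))

∑-distrib-+ : ∀ {n} (f g : Fin n → ℤ) → ∑ (λ i → f i + g i) ≡ ∑ f + ∑ g
∑-distrib-+ f g = trans (∑≡sum (λ i → f i + g i))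
  (trans (Sum.∑-distrib-+ f g) (sym (cong₂ _+_ (∑≡sum f) (∑≡sum g))))

*-distribˡ-∑ : ∀ {n} (c : ℤ) (f : Fin n → ℤ) → c * ∑ f ≡ ∑ (λ i → c * f i)
*-distribˡ-∑ c f = trans (cong (c *_) (∑≡sum f))
  (trans (Sum.*-distribˡ-sum c f) (sym (∑≡sum (λ i → c * f i))))

∑-comm : ∀ {m n} (F : Fin m → Fin n → ℤ) →
         ∑ (λ i → ∑ (F i)) ≡ ∑ (λ j → ∑ (λ i → F i j))
∑-comm F = trans (∑∑≡sumsum F) (trans (Sum.∑-comm F) (sym (∑∑≡sumsum (λ j i → F i j))))
  where
  ∑∑≡sumsum : ∀ {m n} (F : Fin m → Fin n → ℤ) →
              ∑ (λ i → ∑ (F i)) ≡ Sum.sum (λ i → Sum.sum (F i))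
  ∑∑≡sumsum F = trans (∑-cong (λ i → ∑≡sum (F i))) (∑≡sum (λ i → Sum.sum (F i)))

∑-neg : ∀ {n} (f : Fin n → ℤ) → ∑ (λ i → - f i) ≡ - ∑ f
∑-neg {zero}  f = refl
∑-neg {suc n} f = trans (cong (_+_ (- f zero)) (∑-neg (f ∘ suc)))
  (sym (ℤP.neg-distrib-+ (f zero) _))

∑-distrib-- : ∀ {n} (f g : Fin n → ℤ) → ∑ (λ i → f i - g i) ≡ ∑ f - ∑ g
∑-distrib-- f g = trans (∑-distrib-+ f (λ i → - g i)) (cong (_+_ (∑ f)) (∑-neg g))

∑-zero : ∀ {n} {f : Fin n → ℤ} → (∀ i → f i ≡ + 0) → ∑ f ≡ + 0
∑-zero {n} {f} f≗0 = trans (∑≡sum f) (trans (Sum.sum-cong-≗ f≗0) (Sum.sum-replicate-zero n))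

∑-single : ∀ {n} (f : Fin n → ℤ) (j : Fin n) → (∀ i → ¬ i ≡ j → f i ≡ + 0) → ∑ f ≡ f j
∑-single {suc n} f zero    f≗0 =
  trans (cong (_+_ (f zero)) (∑-zero (λ i → f≗0 (suc i) (λ ())))) (ℤP.+-identityʳ _)
∑-single {suc n} f (suc j) f≗0 =
  trans (cong₂ _+_ (f≗0 zero (λ ()))
                   (∑-single (f ∘ suc) j (λ i i≢j → f≗0 (suc i) (i≢j ∘ FP.suc-injective))))
        (ℤP.+-identityˡ _)

∑∑-distrib-+ : ∀ {m n} (F H : Fin m → Fin n → ℤ) →
               ∑ (λ i → ∑ (λ j → F i j + H i j)) ≡ ∑ (λ i → ∑ (F i)) + ∑ (λ i → ∑ (H i))
∑∑-distrib-+ F H = trans (∑-cong (λ i → ∑-distrib-+ (F i) (H i)))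
                         (∑-distrib-+ (λ i → ∑ (F i)) (λ i → ∑ (H i)))

∑-antisym : ∀ {n} (F : Fin n → Fin n → ℤ) → (∀ i j → F i j ≡ - F j i) →
            ∑ (λ i → ∑ (F i)) ≡ + 0
∑-antisym F anti = i≡-i⇒i≡0 (begin
    ∑ (λ i → ∑ (F i))            ≡⟨ ∑-comm F ⟩
    ∑ (λ j → ∑ (λ i → F i j))    ≡⟨ ∑-cong (λ j → ∑-cong (λ i → anti i j)) ⟩
    ∑ (λ j → ∑ (λ i → - F j i))  ≡⟨ ∑-cong (λ j → ∑-neg (F j)) ⟩
    ∑ (λ j → - ∑ (F j))          ≡⟨ ∑-neg (λ j → ∑ (F j)) ⟩
    - ∑ (λ i → ∑ (F i))          ∎)
  where open ≡-Reasoning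

∑-mono-≤ : ∀ {n} {f g : Fin n → ℤ} → (∀ i → f i ≤ g i) → ∑ f ≤ ∑ g
∑-mono-≤ {zero}  f≤g = ℤP.≤-refl
∑-mono-≤ {suc n} f≤g = ℤP.+-mono-≤ (f≤g zero) (∑-mono-≤ (f≤g ∘ suc))

∑-nonNeg : ∀ {n} {f : Fin n → ℤ} → (∀ i → + 0 ≤ f i) → + 0 ≤ ∑ f
∑-nonNeg {n} {f} 0≤f = subst (_≤ ∑ f) (∑-zero {n} (λ _ → refl)) (∑-mono-≤ 0≤f)

∑-nonPos : ∀ {n} {f : Fin n → ℤ} → (∀ i → f i ≤ + 0) → ∑ f ≤ + 0
∑-nonPos {n} {f} f≤0 = subst (∑ f ≤_) (∑-zero {n} (λ _ → refl)) (∑-mono-≤ f≤0)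

term≤∑ : ∀ {n} (f : Fin n → ℤ) → (∀ i → + 0 ≤ f i) → ∀ j → f j ≤ ∑ f
term≤∑ f 0≤f zero    = subst (_≤ ∑ f) (ℤP.+-identityʳ (f zero))
  (ℤP.+-monoʳ-≤ (f zero) (∑-nonNeg (0≤f ∘ suc)))
term≤∑ f 0≤f (suc j) = subst (_≤ ∑ f) (ℤP.+-identityˡ (f (suc j)))
  (ℤP.+-mono-≤ (0≤f zero) (term≤∑ (f ∘ suc) (0≤f ∘ suc) j))

∑≤term : ∀ {n} (f : Fin n → ℤ) → (∀ i → f i ≤ + 0) → ∀ j → ∑ f ≤ f j
∑≤term f f≤0 zero    = subst (∑ f ≤_) (ℤP.+-identityʳ (f zero))
  (ℤP.+-monoʳ-≤ (f zero) (∑-nonPos (f≤0 ∘ suc)))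
∑≤term f f≤0 (suc j) = subst (∑ f ≤_) (ℤP.+-identityˡ (f (suc j)))
  (ℤP.+-mono-≤ (f≤0 zero) (∑≤term (f ∘ suc) (f≤0 ∘ suc) j))

δ : ∀ {n} → Fin n → Fin n → ℤ
δ q R = 𝟙 (does (R F.≟ q))

δ-self : ∀ {n} (q : Fin n) → δ q q ≡ + 1
δ-self q = cong 𝟙 (dec-true (q F.≟ q) refl)

δ-≢ : ∀ {n} (q R : Fin n) → ¬ R ≡ q → δ q R ≡ + 0
δ-≢ q R R≢q = cong 𝟙 (dec-false (R F.≟ q) R≢q)

δ-nonNeg : ∀ {n} (q R : Fin n) → + 0 ≤ δ q R
δ-nonNeg q R = 𝟙-nonNeg _

∑-δ : ∀ {n} (q : Fin n) → ∑ (δ q) ≡ + 1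
∑-δ q = trans (∑-single (δ q) q (δ-≢ q)) (δ-self q)

-δ-nonNeg : ∀ {n} (E : Fin n → ℤ) q → (∀ i → + 0 ≤ E i) → + 1 ≤ E q → ∀ i → + 0 ≤ E i - δ q i
-δ-nonNeg E q E≥0 1≤Eq i with i F.≟ q
... | yes refl = ℤP.i≤j⇒0≤j-i 1≤Eq
... | no _     = subst (+ 0 ≤_) (sym (ℤP.+-identityʳ (E i))) (E≥0 i)

another : ∀ {n} → 2 ℕ.≤ n → (p : Fin n) → ∃ λ q → ¬ q ≡ p
another (s≤s (s≤s z≤n)) zero    = suc zero , λ ()
another (s≤s (s≤s z≤n)) (suc p) = zero , λ ()

argmin : ∀ {n} (g : Fin n → ℤ) → Fin n → ∃ λ j → ∀ i → g j ≤ g i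
argmin {suc zero}    g _ = zero , λ { zero → ℤP.≤-refl }
argmin {suc (suc n)} g _ with argmin (g ∘ suc) zero
... | j , min with g zero ℤ.≤? g (suc j)
...   | yes g0≤gj = zero , λ { zero → ℤP.≤-refl ; (suc i) → ℤP.≤-trans g0≤gj (min i) }
...   | no g0≰gj  = suc j , λ { zero → ℤP.<⇒≤ (ℤP.≰⇒> g0≰gj) ; (suc i) → min i }

Fin-bounded : ∀ {n} (f : Fin n → ℕ) → ∃ λ B → ∀ i → f i ℕ.≤ B
Fin-bounded {zero}  f = 0 , λ ()
Fin-bounded {suc n} f with Fin-bounded (f ∘ suc)
... | B , f≤B = f zero ℕ.⊔ B ,
  λ { zero → ℕP.m≤m⊔n (f zero) B ; (suc i) → ℕP.≤-trans (f≤B i) (ℕP.m≤n⊔m (f zero) B) }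

maximal-witness : ∀ {P : ℕ → Set} → Decidable P → P 0 → (b : ℕ) → (∀ k → b ℕ.< k → ¬ P k) →
                  ∃ λ k → P k × (∀ k′ → k ℕ.< k′ → ¬ P k′)
maximal-witness P? P0 zero    above = zero , P0 , above
maximal-witness {P} P? P0 (suc b) above with P? (suc b)
... | yes Pb = suc b , Pb , above
... | no ¬Pb = maximal-witness P? P0 b above′
  where
  above′ : ∀ k → b ℕ.< k → ¬ P k
  above′ k b<k with ℕP.m≤n⇒m<n∨m≡n b<k
  ... | inj₁ 1+b<k  = above k 1+b<k
  ... | inj₂ refl   = ¬Pb

-- Exhaustive search

Searchable : Set → Set₁
Searchable A = ∀ {P : A → Set} → Decidable P → Dec (∃ P)

Vec-searchable : ∀ {A} → Searchable A → ∀ m → Searchable (Vec A m)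
Vec-searchable search zero    P? = map′ ([] ,_) (λ { ([] , p) → p }) (P? [])
Vec-searchable search (suc m) P? =
  map′ (λ (x , xs , p) → x ∷ xs , p) (λ { (x ∷ xs , p) → x , xs , p })
       (search (λ x → Vec-searchable search m (λ xs → P? (x ∷ xs))))

fromVec : ∀ {m n} → Vec (Fin m) n → Fin n → ℤ
fromVec v i = + toℕ (lookup v i)

fromVec-surjective : ∀ {n} B (g : Fin n → ℤ) → (∀ i → + 0 ≤ g i) → (∀ i → g i ≤ + B) →
                     ∃ λ (v : Vec (Fin (suc B)) n) → fromVec v ≗ g
fromVec-surjective {n} B g 0≤g g≤B = tabulate code , λ i → begin
    + toℕ (lookup (tabulate code) i)  ≡⟨ cong (+_ ∘ toℕ) (VP.lookup∘tabulate code i) ⟩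
    + toℕ (code i)                    ≡⟨ cong +_ (FP.toℕ-fromℕ< (∣g∣<1+B i)) ⟩
    + ∣ g i ∣                          ≡⟨ ℤP.0≤i⇒+∣i∣≡i (0≤g i) ⟩
    g i                               ∎
  where
  open ≡-Reasoning
  ∣g∣<1+B : ∀ i → ∣ g i ∣ ℕ.< suc B
  ∣g∣<1+B i = s≤s (ℤP.drop‿+≤+ (subst (_≤ + B) (sym (ℤP.0≤i⇒+∣i∣≡i (0≤g i))) (g≤B i)))
  code : Fin n → Fin (suc B)
  code i = fromℕ< (∣g∣<1+B i)

effective-fromVec : ∀ {n} (E : Fin n → ℤ) {k} → (∀ i → + 0 ≤ E i) → ∑ E ≡ + k →
                    ∃ λ (v : Vec (Fin (suc k)) n) → fromVec v ≗ E
effective-fromVec E {k} E≥0 ∑E≡k =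
  fromVec-surjective k E E≥0 (λ i → subst (E i ≤_) ∑E≡k (term≤∑ E E≥0 i))

-- The Laplacian and linear equivalence

module _ (G : SimpleGraph) where
  open SimpleGraph G renaming (sym to adj-sym)

  flow : (Fin n → ℤ) → Fin n → Fin n → ℤ
  flow f Q R = if adj Q R then f Q - f R else + 0

  flow-antisym : ∀ f Q R → flow f Q R ≡ - flow f R Q
  flow-antisym f Q R rewrite adj-sym R Q with adj Q R
  ... | true  = i-j≡-[j-i] (f Q) (f R)
  ... | false = refl

  flow-+ : ∀ f g Q R → flow (λ u → f u + g u) Q R ≡ flow f Q R + flow g Q R
  flow-+ f g Q R with adj Q R
  ... | true  = [i+j]-[k+l]≡[i-k]+[j-l] (f Q) (g Q) (f R) (g R)
  ... | false = refl

  flow-neg : ∀ f Q R → flow (λ u → - f u) Q R ≡ - flow f Q R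
  flow-neg f Q R with adj Q R
  ... | true  = -i--j≡-[i-j] (f Q) (f R)
  ... | false = refl

  flow-const : ∀ c Q R → flow (λ _ → c) Q R ≡ + 0
  flow-const c Q R with adj Q R
  ... | true  = ℤP.+-inverseʳ c
  ... | false = refl

  Δ-cong : ∀ {f g} → f ≗ g → Δ G f ≗ Δ G g
  Δ-cong {f} {g} f≗g Q = ∑-cong flow≗
    where
    flow≗ : flow f Q ≗ flow g Q
    flow≗ R with adj Q R
    ... | true  = cong₂ _-_ (f≗g Q) (f≗g R)
    ... | false = refl

  Δ-distrib-+ : ∀ f g Q → Δ G (λ u → f u + g u) Q ≡ Δ G f Q + Δ G g Q
  Δ-distrib-+ f g Q = trans (∑-cong (flow-+ f g Q)) (∑-distrib-+ (flow f Q) (flow g Q))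

  Δ-neg : ∀ f Q → Δ G (λ u → - f u) Q ≡ - Δ G f Q
  Δ-neg f Q = trans (∑-cong (flow-neg f Q)) (∑-neg (flow f Q))

  Δ-const : ∀ c Q → Δ G (λ _ → c) Q ≡ + 0
  Δ-const c Q = ∑-zero (flow-const c Q)

  Δ-+const : ∀ f c Q → Δ G (λ u → f u + c) Q ≡ Δ G f Q
  Δ-+const f c Q = trans (Δ-distrib-+ f (λ _ → c) Q)
    (trans (cong (_+_ (Δ G f Q)) (Δ-const c Q)) (ℤP.+-identityʳ _))

  deg-Δ : ∀ f → deg G (Δ G f) ≡ + 0
  deg-Δ f = ∑-antisym (flow f) (flow-antisym f)

  -- Oriented so that InLinSys G D E is, by definition, Effective G E × E ~ D.
  infix 4 _~_
  _~_ : Divisor G → Divisor G → Set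
  X ~ Y = ∃ λ f → ∀ Q → X Q - Y Q ≡ Δ G f Q

  ≗⇒~ : ∀ {X Y} → X ≗ Y → X ~ Y
  ≗⇒~ {X} {Y} X≗Y = (λ _ → + 0) , λ Q →
    trans (ℤP.i≡j⇒i-j≡0 (X≗Y Q)) (sym (Δ-const (+ 0) Q))

  ~-sym : ∀ {X Y} → X ~ Y → Y ~ X
  ~-sym {X} {Y} (f , X-Y≡Δf) = (λ u → - f u) , λ Q → begin
    Y Q - X Q       ≡⟨ i-j≡-[j-i] (Y Q) (X Q) ⟩
    - (X Q - Y Q)   ≡⟨ cong -_ (X-Y≡Δf Q) ⟩
    - Δ G f Q       ≡⟨ Δ-neg f Q ⟨
    Δ G (λ u → - f u) Q ∎
    where open ≡-Reasoning

  ~-trans : ∀ {X Y Z} → X ~ Y → Y ~ Z → X ~ Z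
  ~-trans {X} {Y} {Z} (f , X-Y≡Δf) (g , Y-Z≡Δg) = (λ u → f u + g u) , λ Q → begin
    X Q - Z Q                  ≡⟨ ℤP.+-minus-telescope (X Q) (Y Q) (Z Q) ⟨
    (X Q - Y Q) + (Y Q - Z Q)  ≡⟨ cong₂ _+_ (X-Y≡Δf Q) (Y-Z≡Δg Q) ⟩
    Δ G f Q + Δ G g Q          ≡⟨ Δ-distrib-+ f g Q ⟨
    Δ G (λ u → f u + g u) Q    ∎
    where
    open ≡-Reasoning

  ~-⊖ : ∀ {X Y} Z → X ~ Y → _⊖_ G X Z ~ _⊖_ G Y Z
  ~-⊖ {X} {Y} Z (f , X-Y≡Δf) = f , λ Q → trans (cancel (X Q) (Y Q) (Z Q)) (X-Y≡Δf Q)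
    where
    cancel : ∀ x y z → (x - z) - (y - z) ≡ x - y
    cancel = solve-∀

  LinSysNonempty-resp-~ : ∀ {X Y} → X ~ Y → LinSysNonempty G X → LinSysNonempty G Y
  LinSysNonempty-resp-~ {X} {Y} X~Y (E , E≥0 , E~X) = E , E≥0 , ~-trans {E} {X} {Y} E~X X~Y

  LinSysNonempty-resp-≗ : ∀ {X Y} → X ≗ Y → LinSysNonempty G X → LinSysNonempty G Y
  LinSysNonempty-resp-≗ {X} {Y} = LinSysNonempty-resp-~ {X} {Y} ∘ ≗⇒~

  effective⇒LinSysNonempty : ∀ {X} → Effective G X → LinSysNonempty G X
  effective⇒LinSysNonempty {X} X≥0 = X , X≥0 , ≗⇒~ {X} {X} (λ _ → refl)

  LinSysNonempty⇒deg≥0 : ∀ X → LinSysNonempty G X → + 0 ≤ deg G X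
  LinSysNonempty⇒deg≥0 X (E , E≥0 , f , E-X≡Δf) = subst (+ 0 ≤_) degE≡degX (∑-nonNeg E≥0)
    where
    degE≡degX : ∑ E ≡ ∑ X
    degE≡degX = ℤP.i-j≡0⇒i≡j (∑ E) (∑ X)
      (trans (sym (∑-distrib-- E X)) (trans (∑-cong E-X≡Δf) (deg-Δ f)))

  infixl 6 _+Δ_
  _+Δ_ : Divisor G → (Fin n → ℤ) → Divisor G
  (D +Δ f) Q = D Q + Δ G f Q

  +Δ-~ : ∀ D f → (D +Δ f) ~ D
  +Δ-~ D f = f , λ Q → [i+j]-i≡j (D Q) (Δ G f Q)

  +Δ⇒LinSysNonempty : ∀ {D} f → Effective G (D +Δ f) → LinSysNonempty G D
  +Δ⇒LinSysNonempty {D} f D+Δf≥0 = D +Δ f , D+Δf≥0 , +Δ-~ D f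

  LinSysNonempty⇒+Δ : ∀ {D} → LinSysNonempty G D → ∃ λ f → Effective G (D +Δ f)
  LinSysNonempty⇒+Δ {D} (E , E≥0 , f , E-D≡Δf) = f , λ Q →
    subst (+ 0 ≤_) (trans (i≡j+[i-j] (E Q) (D Q)) (cong (_+_ (D Q)) (E-D≡Δf Q))) (E≥0 Q)

  adj⇒≢ : ∀ {u v} → adj u v ≡ true → ¬ u ≡ v
  adj⇒≢ {u} uv refl with trans (sym (loopless u)) uv
  ... | ()

  outdeg : (Fin n → Bool) → Fin n → ℤ
  outdeg s u = ∑ (λ x → 𝟙 (adj u x ∧ not (s x)))

  cut : (Fin n → Bool) → (Fin n → ℤ) → Fin n → Fin n → ℤ
  cut s f w x = 𝟙 (s w) * 𝟙 (not (s x)) * flow f w x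

  -- The flow along edges inside s cancels in pairs.
  ∑-𝟙*Δ≡∑∑cut : ∀ (s : Fin n → Bool) f → ∑ (λ w → 𝟙 (s w) * Δ G f w) ≡ ∑ (λ w → ∑ (cut s f w))
  ∑-𝟙*Δ≡∑∑cut s f = begin
      ∑ (λ w → 𝟙 (s w) * Δ G f w)
    ≡⟨ ∑-cong (λ w → *-distribˡ-∑ (𝟙 (s w)) (flow f w)) ⟩
      ∑ (λ w → ∑ (λ x → 𝟙 (s w) * flow f w x))
    ≡⟨ ∑-cong (λ w → ∑-cong (split w)) ⟩
      ∑ (λ w → ∑ (λ x → inner w x + cut s f w x))
    ≡⟨ ∑∑-distrib-+ inner (cut s f) ⟩
      ∑ (λ w → ∑ (inner w)) + ∑ (λ w → ∑ (cut s f w))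
    ≡⟨ cong (_+ ∑ (λ w → ∑ (cut s f w))) (∑-antisym inner inner-antisym) ⟩
      + 0 + ∑ (λ w → ∑ (cut s f w))
    ≡⟨ ℤP.+-identityˡ _ ⟩
      ∑ (λ w → ∑ (cut s f w))
    ∎
    where
    open ≡-Reasoning
    inner : Fin n → Fin n → ℤ
    inner w x = 𝟙 (s w) * 𝟙 (s x) * flow f w x
    swap : ∀ a b c → a * b * - c ≡ - (b * a * c)
    swap = solve-∀
    inner-antisym : ∀ w x → inner w x ≡ - inner x w
    inner-antisym w x = trans (cong (𝟙 (s w) * 𝟙 (s x) *_) (flow-antisym f w x))
                              (swap (𝟙 (s w)) (𝟙 (s x)) (flow f x w))
    distrib : ∀ a p q c → a * (p + q) * c ≡ a * p * c + a * q * c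
    distrib = solve-∀
    split : ∀ w x → 𝟙 (s w) * flow f w x ≡ inner w x + cut s f w x
    split w x = trans (cong (λ t → t * flow f w x) (sym (ℤP.*-identityʳ (𝟙 (s w)))))
      (trans (cong (λ t → 𝟙 (s w) * t * flow f w x) (sym (𝟙+𝟙-not (s x))))
             (distrib (𝟙 (s w)) (𝟙 (s x)) (𝟙 (not (s x))) (flow f w x)))

  sublevel : (Fin n → ℤ) → ℤ → Fin n → Bool
  sublevel f c v = does (f v ℤ.≤? c)

  cut-sublevel-nonPos : ∀ f c w x → cut (sublevel f c) f w x ≤ + 0
  cut-sublevel-nonPos f c w x with f w ℤ.≤? c | f x ℤ.≤? c | adj w x
  ... | yes fw≤c | no fx≰c | true  = subst (_≤ + 0) (sym (ℤP.*-identityˡ (f w - f x)))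
        (ℤP.i≤j⇒i-j≤0 (ℤP.<⇒≤ (ℤP.≤-<-trans fw≤c (ℤP.≰⇒> fx≰c))))
  ... | yes _    | no _    | false = ℤP.≤-refl
  ... | yes _    | yes _   | _     = ℤP.≤-refl
  ... | no _     | _       | _     = ℤP.≤-refl

  cut-sublevel-edge : ∀ f u R → adj u R ≡ true → f u < f R → cut (sublevel f (f u)) f u R ≡ f u - f R
  cut-sublevel-edge f u R uR fu<fR with f u ℤ.≤? f u | f R ℤ.≤? f u
  ... | no fu≰fu | _       = ⊥-elim (fu≰fu ℤP.≤-refl)
  ... | yes _    | yes fR≤fu = ⊥-elim (ℤP.<⇒≱ fu<fR fR≤fu)
  ... | yes _    | no _    rewrite uR = ℤP.*-identityˡ (f u - f R)

  mass : Divisor G → ℕ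
  mass D = ∣ ∑ (λ w → + ∣ D w ∣) ∣

  ∑𝟙*≤mass : ∀ (s : Fin n → Bool) D → ∑ (λ w → 𝟙 (s w) * D w) ≤ + mass D
  ∑𝟙*≤mass s D = subst (∑ (λ w → 𝟙 (s w) * D w) ≤_)
                       (sym (ℤP.0≤i⇒+∣i∣≡i (∑-nonNeg {f = λ w → + ∣ D w ∣} (λ w → +≤+ z≤n))))
                       (∑-mono-≤ {f = λ w → 𝟙 (s w) * D w} (λ w → 𝟙*≤∣∣ (s w) (D w)))
    where
    𝟙*≤∣∣ : ∀ b x → 𝟙 b * x ≤ + ∣ x ∣
    𝟙*≤∣∣ true  (+ x)      = subst (_≤ + x) (sym (ℤP.*-identityˡ (+ x))) ℤP.≤-refl
    𝟙*≤∣∣ true  -[1+ x ]   = ℤ.-≤+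
    𝟙*≤∣∣ false _          = +≤+ z≤n

  -- Sum the effectivity of D + Δ f over the sublevel set of f at u: the edge uR is cut.
  edge-bound : ∀ D f → Effective G (D +Δ f) → ∀ u R → adj u R ≡ true → f R ≤ f u + + mass D
  edge-bound D f D+Δf≥0 u R uR with f R ℤ.≤? f u
  ... | yes fR≤fu = ℤP.≤-trans fR≤fu
                      (subst (_≤ f u + + mass D) (ℤP.+-identityʳ (f u)) (ℤP.+-monoʳ-≤ (f u) (+≤+ z≤n)))
  ... | no fR≰fu  = ℤP.0≤i-j⇒j≤i (subst (+ 0 ≤_) (rearrange (f u) (f R) (+ mass D)) (begin
      + 0                                ≤⟨ ∑-nonNeg {f = λ w → 𝟙 (S w) * (D +Δ f) w} S∩[D+Δf]≥0 ⟩
      ∑ (λ w → 𝟙 (S w) * (D +Δ f) w)     ≡⟨ ∑-cong (λ w → ℤP.*-distribˡ-+ (𝟙 (S w)) (D w) (Δ G f w)) ⟩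
      ∑ (λ w → S∩D w + S∩Δf w)          ≡⟨ ∑-distrib-+ S∩D S∩Δf ⟩
      ∑ S∩D + ∑ S∩Δf                     ≡⟨ cong (_+_ (∑ S∩D)) (∑-𝟙*Δ≡∑∑cut S f) ⟩
      ∑ S∩D + ∑ (λ w → ∑ (cut S f w))    ≤⟨ ℤP.+-mono-≤ (∑𝟙*≤mass S D) ∑∑cut≤ ⟩
      + mass D + (f u - f R)             ∎))
    where
    open ℤP.≤-Reasoning
    S : Fin n → Bool
    S = sublevel f (f u)
    S∩D S∩Δf : Fin n → ℤ
    S∩D w = 𝟙 (S w) * D w
    S∩Δf w = 𝟙 (S w) * Δ G f w
    𝟙*-nonNeg : ∀ b {x} → + 0 ≤ x → + 0 ≤ 𝟙 b * x
    𝟙*-nonNeg true  {x} 0≤x = subst (+ 0 ≤_) (sym (ℤP.*-identityˡ x)) 0≤x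
    𝟙*-nonNeg false _       = ℤP.≤-refl
    S∩[D+Δf]≥0 : ∀ w → + 0 ≤ 𝟙 (S w) * (D +Δ f) w
    S∩[D+Δf]≥0 w = 𝟙*-nonNeg (S w) (D+Δf≥0 w)
    ∑∑cut≤ : ∑ (λ w → ∑ (cut S f w)) ≤ f u - f R
    ∑∑cut≤ = ℤP.≤-trans
      (∑≤term (λ w → ∑ (cut S f w)) (λ w → ∑-nonPos (cut-sublevel-nonPos f (f u) w)) u)
             (ℤP.≤-trans (∑≤term (cut S f u) (cut-sublevel-nonPos f (f u) u) R)
                         (ℤP.≤-reflexive (cut-sublevel-edge f u R uR (ℤP.≰⇒> fR≰fu))))
    rearrange : ∀ a b m → m + (a - b) ≡ (a + m) - b
    rearrange = solve-∀

  length : ∀ {a b} → Reachable adj a b → ℕ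
  length here       = 0
  length (step _ p) = suc (length p)

  path-bound : ∀ (f : Fin n → ℤ) M → (∀ u R → adj u R ≡ true → f R ≤ f u + + M) →
               ∀ {a b} (p : Reachable adj a b) → f b ≤ f a + + (length p ℕ.* M)
  path-bound f M edge≤ {a} here = ℤP.≤-reflexive (sym (ℤP.+-identityʳ (f a)))
  path-bound f M edge≤ {a} (step {w = w} aw p) = ℤP.≤-trans (path-bound f M edge≤ p)
    (subst (_ ≤_) (ℤP.+-assoc (f a) (+ M) (+ (length p ℕ.* M))) (ℤP.+-monoˡ-≤ _ (edge≤ a w aw)))

  diameter : ℕ
  diameter = proj₁ (Fin-bounded (λ a → proj₁ (Fin-bounded (λ b → length (connected a b)))))

  length≤diameter : ∀ a b → length (connected a b) ℕ.≤ diameter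
  length≤diameter a b = ℕP.≤-trans (proj₂ (Fin-bounded (λ b → length (connected a b))) b)
    (proj₂ (Fin-bounded (λ a → proj₁ (Fin-bounded (λ b → length (connected a b))))) a)

  spread : Divisor G → ℕ
  spread D = diameter ℕ.* mass D

  potential-bound : ∀ D f → Effective G (D +Δ f) → ∀ a b → f b ≤ f a + + spread D
  potential-bound D f D+Δf≥0 a b =
    ℤP.≤-trans (path-bound f (mass D) (edge-bound D f D+Δf≥0) (connected a b))
               (ℤP.+-monoʳ-≤ (f a) (+≤+ (ℕP.*-monoˡ-≤ (mass D) (length≤diameter a b))))

  -- Normalising at q, potential-bound confines a solution to the box [−spread, spread].
  normalised-potential : ∀ D f → Effective G (D +Δ f) → ∀ q →
    let B = spread D in
    ∃ λ (v : Vec (Fin (suc (B ℕ.+ B))) n) → Effective G (D +Δ (λ i → fromVec v i - + B))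
  normalised-potential D f D+Δf≥0 q = v , λ Q → subst (λ x → + 0 ≤ D Q + x) (sym (Δv≡Δf Q)) (D+Δf≥0 Q)
    where
    B : ℕ
    B = spread D
    g : Fin n → ℤ
    g i = f i - f q + + B
    0≤g : ∀ i → + 0 ≤ g i
    0≤g i = subst (+ 0 ≤_) (reassoc (f i) (f q) (+ B)) (ℤP.i≤j⇒0≤j-i (potential-bound D f D+Δf≥0 i q))
      where
      reassoc : ∀ a b c → (a + c) - b ≡ a - b + c
      reassoc = solve-∀
    g≤2B : ∀ i → g i ≤ + (B ℕ.+ B)
    g≤2B i = ℤP.+-monoˡ-≤ (+ B) (subst (f i - f q ≤_) ([i+j]-i≡j (f q) (+ B))
               (ℤP.+-monoˡ-≤ (- f q) (potential-bound D f D+Δf≥0 q i)))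
    v : Vec (Fin (suc (B ℕ.+ B))) n
    v = proj₁ (fromVec-surjective (B ℕ.+ B) g 0≤g g≤2B)
    Δv≡Δf : ∀ Q → Δ G (λ i → fromVec v i - + B) Q ≡ Δ G f Q
    Δv≡Δf Q = trans (Δ-cong v≗f-fq Q) (Δ-+const f (- f q) Q)
      where
      cancel : ∀ a b c → a - b + c - c ≡ a + - b
      cancel = solve-∀
      v≗f-fq : ∀ i → fromVec v i - + B ≡ f i + - f q
      v≗f-fq i = trans (cong (_- + B) (proj₂ (fromVec-surjective (B ℕ.+ B) g 0≤g g≤2B) i))
                       (cancel (f i) (f q) (+ B))

  outdeg-cong : ∀ {s t} → s ≗ t → ∀ u → outdeg s u ≡ outdeg t u
  outdeg-cong s≗t u = ∑-cong (λ x → cong (λ b → 𝟙 (adj u x ∧ not b)) (s≗t x))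

  Δ𝟙-inside : ∀ s w → s w ≡ true → Δ G (𝟙 ∘ s) w ≡ outdeg s w
  Δ𝟙-inside s w sw = ∑-cong term
    where
    term : ∀ x → flow (𝟙 ∘ s) w x ≡ 𝟙 (adj w x ∧ not (s x))
    term x with adj w x | s x
    ... | true  | true  rewrite sw = refl
    ... | true  | false rewrite sw = refl
    ... | false | _     = refl

  Δ𝟙-outside : ∀ s w → s w ≡ false → Δ G (𝟙 ∘ s) w ≤ + 0
  Δ𝟙-outside s w sw = ∑-nonPos term
    where
    term : ∀ x → flow (𝟙 ∘ s) w x ≤ + 0
    term x with adj w x | s x
    ... | true  | true  rewrite sw = ℤ.-≤+
    ... | true  | false rewrite sw = ℤP.≤-refl
    ... | false | _     = ℤP.≤-refl

  fire-effective : ∀ D f s → Effective G (D +Δ f) → (∀ u → s u ≡ true → outdeg s u ≤ (D +Δ f) u) →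
                   Effective G (D +Δ (λ i → f i - 𝟙 (s i)))
  fire-effective D f s D+Δf≥0 legal w = subst (+ 0 ≤_) (sym split) (fired (s w) refl)
    where
    split : (D +Δ (λ i → f i - 𝟙 (s i))) w ≡ (D +Δ f) w - Δ G (𝟙 ∘ s) w
    split = trans (cong (_+_ (D w)) (trans (Δ-distrib-+ f (λ i → - 𝟙 (s i)) w)
                                          (cong (_+_ (Δ G f w)) (Δ-neg (𝟙 ∘ s) w))))
                  (sym (ℤP.+-assoc (D w) (Δ G f w) _))
    fired : ∀ b → s w ≡ b → + 0 ≤ (D +Δ f) w - Δ G (𝟙 ∘ s) w
    fired true  sw = subst (λ x → + 0 ≤ (D +Δ f) w - x) (sym (Δ𝟙-inside s w sw))
                           (ℤP.i≤j⇒0≤j-i (legal w sw))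
    fired false sw = ℤP.≤-trans (D+Δf≥0 w)
      (subst (_≤ (D +Δ f) w - Δ G (𝟙 ∘ s) w) (ℤP.+-identityʳ _)
             (ℤP.+-monoʳ-≤ ((D +Δ f) w) (ℤP.neg-mono-≤ (Δ𝟙-outside s w sw))))

  sublevel-≤ : ∀ g c w → sublevel g c w ≡ true → g w ≤ c
  sublevel-≤ g c w Sw with g w ℤ.≤? c
  ... | yes gw≤c = gw≤c

  -- Every edge leaving the set where g is minimal raises g by at least 1.
  minimum-set-legal : ∀ X g j → Effective G (X +Δ g) → (∀ i → g j ≤ g i) →
                      ∀ w → sublevel g (g j) w ≡ true → outdeg (sublevel g (g j)) w ≤ X w
  minimum-set-legal X g j X+Δg≥0 min w Sw = ℤP.0≤i-j⇒j≤i
    (subst (+ 0 ≤_) (cancel (X w) (Δ G g w) (outdeg S w))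
           (ℤP.+-mono-≤ (X+Δg≥0 w) (ℤP.i≤j⇒0≤j-i Δ+outdeg≤0)))
    where
    S : Fin n → Bool
    S = sublevel g (g j)
    cancel : ∀ x d o → (x + d) + (+ 0 - (d + o)) ≡ x - o
    cancel = solve-∀
    shuffle : ∀ a b → b - (+ 1 + a) ≡ + 0 - (a - b + + 1)
    shuffle = solve-∀
    gw≤gj : g w ≤ g j
    gw≤gj = sublevel-≤ g (g j) w Sw
    term : ∀ x → flow g w x + 𝟙 (adj w x ∧ not (S x)) ≤ + 0
    term x with adj w x | g x ℤ.≤? g j
    ... | false | _        = ℤP.≤-refl
    ... | true  | yes _    = subst (_≤ + 0) (sym (ℤP.+-identityʳ (g w - g x)))
                               (ℤP.i≤j⇒i-j≤0 (ℤP.≤-trans gw≤gj (min x)))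
    ... | true  | no gx≰gj = ℤP.0≤i-j⇒j≤i (subst (+ 0 ≤_) (shuffle (g w) (g x))
                               (ℤP.i≤j⇒0≤j-i (ℤP.i<j⇒suc[i]≤j (ℤP.≤-<-trans gw≤gj (ℤP.≰⇒> gx≰gj)))))
    Δ+outdeg≤0 : Δ G g w + outdeg S w ≤ + 0
    Δ+outdeg≤0 = subst (_≤ + 0) (∑-distrib-+ (flow g w) (λ x → 𝟙 (adj w x ∧ not (S x)))) (∑-nonPos term)

  -- Reduced divisors

  module _ (P : Fin n) where

    linSysNonempty? : ∀ D → Dec (LinSysNonempty G D)
    linSysNonempty? D = map′ (λ (v , eff) → +Δ⇒LinSysNonempty (potential v) eff)
      (λ l → let f , eff = LinSysNonempty⇒+Δ l in normalised-potential D f eff P)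
      (Vec-searchable FP.any? n (λ v → FP.all? (λ Q → + 0 ℤ.≤? (D +Δ potential v) Q)))
      where
      potential : Vec (Fin (suc (spread D ℕ.+ spread D))) n → Fin n → ℤ
      potential v i = fromVec v i - + spread D

    LegalFiring : Divisor G → (Fin n → Bool) → Set
    LegalFiring E s = s P ≡ false × (∃ λ u → s u ≡ true) × (∀ u → s u ≡ true → outdeg s u ≤ E u)

    Reduced : Divisor G → Set
    Reduced E = ∀ s → ¬ LegalFiring E s

    legalFiring? : ∀ E s → Dec (LegalFiring E s)
    legalFiring? E s = (s P BP.≟ false) ×-dec FP.any? (λ u → s u BP.≟ true)
                       ×-dec FP.all? (λ u → (s u BP.≟ true) →-dec (outdeg s u ℤ.≤? E u))

    LegalFiring-resp-≗ : ∀ {E s t} → s ≗ t → LegalFiring E s → LegalFiring E t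
    LegalFiring-resp-≗ {E} s≗t (sP , (u , su) , legal) =
      trans (sym (s≗t P)) sP , (u , trans (sym (s≗t u)) su) ,
      λ w tw → subst (_≤ E w) (outdeg-cong s≗t w) (legal w (trans (s≗t w) tw))

    legalFiring-exists? : ∀ E → Dec (∃ (LegalFiring E))
    legalFiring-exists? E = map′ (λ (v , legal) → lookup v , legal)
      (λ (s , legal) → tabulate s , LegalFiring-resp-≗ (sym ∘ VP.lookup∘tabulate s) legal)
      (anySubset? (λ v → legalFiring? E (lookup v)))

    -- Firing lowers the potential, normalised by f P = 0, while potential-bound keeps it above −spread.
    reduce : ∀ D → Effective G D → ∃ λ f → Effective G (D +Δ f) × Reduced (D +Δ f)
    reduce D D≥0 = descend ∣ μ (λ _ → + 0) ∣ (λ _ → + 0) refl D+Δ0≥0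
                     (ℤP.≤-reflexive (sym (ℤP.0≤i⇒+∣i∣≡i (μ-nonNeg (λ _ → + 0) refl D+Δ0≥0))))
      where
      B : ℕ
      B = spread D
      μ : (Fin n → ℤ) → ℤ
      μ f = ∑ (λ w → f w + + B)
      D+Δ0≥0 : Effective G (D +Δ (λ _ → + 0))
      D+Δ0≥0 w = subst (+ 0 ≤_)
        (sym (trans (cong (_+_ (D w)) (Δ-const (+ 0) w)) (ℤP.+-identityʳ (D w)))) (D≥0 w)
      μ-nonNeg : ∀ f → f P ≡ + 0 → Effective G (D +Δ f) → + 0 ≤ μ f
      μ-nonNeg f fP≡0 eff = ∑-nonNeg {f = λ w → f w + + B}
        (λ w → subst (_≤ f w + + B) fP≡0 (potential-bound D f eff w P))
      μ-fire : ∀ f (s : Fin n → Bool) → μ (λ i → f i - 𝟙 (s i)) ≡ μ f - ∑ (𝟙 ∘ s)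
      μ-fire f s = trans (∑-cong (λ w → swap (f w) (𝟙 (s w)) (+ B)))
                         (∑-distrib-- (λ w → f w + + B) (𝟙 ∘ s))
        where
        swap : ∀ a b c → a - b + c ≡ a + c - b
        swap = solve-∀
      descend : ∀ k f → f P ≡ + 0 → Effective G (D +Δ f) → μ f ≤ + k →
                ∃ λ f → Effective G (D +Δ f) × Reduced (D +Δ f)
      descend k f fP≡0 eff μ≤k with legalFiring-exists? (D +Δ f)
      ... | no ∄ = f , eff , λ s legal → ∄ (s , legal)
      ... | yes (s , sP , (u , su) , legal) = next k μ′≤k-1
        where
        f′ : Fin n → ℤ
        f′ i = f i - 𝟙 (s i)
        f′P≡0 : f′ P ≡ + 0
        f′P≡0 = trans (cong (λ b → f P - 𝟙 b) sP) (trans (ℤP.+-identityʳ (f P)) fP≡0)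
        eff′ : Effective G (D +Δ f′)
        eff′ = fire-effective D f s eff legal
        1≤∑s : + 1 ≤ ∑ (𝟙 ∘ s)
        1≤∑s = subst (_≤ ∑ (𝟙 ∘ s)) (cong 𝟙 su) (term≤∑ (𝟙 ∘ s) (𝟙-nonNeg ∘ s) u)
        μ′≤k-1 : μ f′ ≤ + k - + 1
        μ′≤k-1 = subst (_≤ + k - + 1) (sym (μ-fire f s)) (ℤP.+-mono-≤ μ≤k (ℤP.neg-mono-≤ 1≤∑s))
        next : ∀ k → μ f′ ≤ + k - + 1 → ∃ λ f → Effective G (D +Δ f) × Reduced (D +Δ f)
        next zero    μ′≤-1 = ⊥-elim (ℤP.<⇒≱ (ℤP.≤-<-trans μ′≤-1 ℤ.-<+) (μ-nonNeg f′ f′P≡0 eff′))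
        next (suc k) μ′≤k  = descend k f′ f′P≡0 eff′ μ′≤k

    reduced-representative : ∀ {D} → LinSysNonempty G D → ∃ λ E → Effective G E × E ~ D × Reduced E
    reduced-representative {D} (E₀ , E₀≥0 , E₀~D) =
      let f , eff , red = reduce E₀ E₀≥0
      in E₀ +Δ f , eff , ~-trans {E₀ +Δ f} {E₀} {D} (+Δ-~ E₀ f) E₀~D , red

    reduced-has-empty-neighbour : ∀ E → Effective G E → Reduced E → ∃ λ Q → adj P Q ≡ true × E Q ≡ + 0
    reduced-has-empty-neighbour E E≥0 red = Q , trans (adj-sym P Q) adjQP , EQ≡0
      where
      s : Fin n → Bool
      s u = not (does (u F.≟ P))
      sP : s P ≡ false
      sP = cong not (dec-true (P F.≟ P) refl)
      o : Fin n
      o = proj₁ (another twoVerts P)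
      so : s o ≡ true
      so = cong not (dec-false (o F.≟ P) (proj₂ (another twoVerts P)))
      violated : ∃ λ u → ¬ (s u ≡ true → outdeg s u ≤ E u)
      violated = FP.¬∀⟶∃¬ n _ (λ u → (s u BP.≟ true) →-dec (outdeg s u ℤ.≤? E u))
                              (λ legal → red s (sP , (o , so) , legal))
      Q : Fin n
      Q = proj₁ violated
      outdeg≰EQ : ¬ (outdeg s Q ≤ E Q)
      outdeg≰EQ le = proj₂ violated (λ _ → le)
      outdeg≡ : outdeg s Q ≡ 𝟙 (adj Q P)
      outdeg≡ = trans (∑-single (λ x → 𝟙 (adj Q x ∧ not (s x))) P outside-P)
                      (trans (cong (λ b → 𝟙 (adj Q P ∧ not b)) sP) (cong 𝟙 (BP.∧-identityʳ (adj Q P))))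
        where
        outside-P : ∀ x → ¬ x ≡ P → 𝟙 (adj Q x ∧ not (s x)) ≡ + 0
        outside-P x x≢P = trans (cong (λ b → 𝟙 (adj Q x ∧ not (not b))) (dec-false (x F.≟ P) x≢P))
                                (cong 𝟙 (BP.∧-zeroʳ (adj Q x)))
      adjQP : adj Q P ≡ true
      adjQP with adj Q P | outdeg≡
      ... | true  | _    = refl
      ... | false | od≡0 = ⊥-elim (outdeg≰EQ (subst (_≤ E Q) (sym od≡0) (E≥0 Q)))
      EQ≡0 : E Q ≡ + 0
      EQ≡0 = 0≤i<1⇒i≡0 (E≥0 Q) (outdeg≰EQ ∘ subst (_≤ E Q) (sym (trans outdeg≡ (cong 𝟙 adjQP))))

    -- A potential g with E − Q + Δ g ≥ 0 would make the set where g is minimal a legal firing.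
    reduced-empty-at-neighbour : ∀ E Q → Reduced E → E P ≡ + 0 → adj P Q ≡ true → E Q ≡ + 0 →
                                 ¬ LinSysNonempty G (_⊖_ G E (δ Q))
    reduced-empty-at-neighbour E Q red EP≡0 adjPQ EQ≡0 l with LinSysNonempty⇒+Δ l
    ... | g , eff = red S (SP , (j , Sj) , λ w Sw → ℤP.≤-trans (legal w Sw)
                             (ℤP.i-j≤i (E w) (δ Q w) ⦃ ℤ.nonNegative (δ-nonNeg Q w) ⦄))
      where
      j : Fin n
      j = proj₁ (argmin g P)
      S : Fin n → Bool
      S = sublevel g (g j)
      legal : ∀ w → S w ≡ true → outdeg S w ≤ E w - δ Q w
      legal = minimum-set-legal (_⊖_ G E (δ Q)) g j eff (proj₂ (argmin g P))
      Sj : S j ≡ true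
      Sj = dec-true (g j ℤ.≤? g j) ℤP.≤-refl
      SQ : S Q ≡ false
      SQ = BP.¬-not λ SQ → ℤP.<⇒≱ ℤ.-<+ (ℤP.≤-trans (∑-nonNeg (λ x → 𝟙-nonNeg (adj Q x ∧ not (S x))))
                             (subst (outdeg S Q ≤_) (cong₂ _-_ EQ≡0 (δ-self Q)) (legal Q SQ)))
      SP : S P ≡ false
      SP = BP.¬-not λ SP → 1≰0 (ℤP.≤-trans 1≤outdeg
             (subst (outdeg S P ≤_) (cong₂ _-_ EP≡0 (δ-≢ Q P (adj⇒≢ adjPQ))) (legal P SP)))
        where
        1≰0 : ¬ (+ 1 ≤ + 0)
        1≰0 (+≤+ ())
        1≤outdeg : + 1 ≤ outdeg S P
        1≤outdeg = subst (_≤ outdeg S P)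
                     (trans (cong (λ b → 𝟙 (adj P Q ∧ not b)) SQ) (cong (λ b → 𝟙 (b ∧ true)) adjPQ))
                     (term≤∑ (λ x → 𝟙 (adj P x ∧ not (S x))) (λ x → 𝟙-nonNeg (adj P x ∧ not (S x))) Q)

    neighbour-obstruction : ∀ D → LinSysNonempty G D → ¬ LinSysNonempty G (_⊖_ G D (δ P)) →
                            ∃ λ Q → adj P Q ≡ true × ¬ LinSysNonempty G (_⊖_ G D (δ Q))
    neighbour-obstruction D l ∅ =
      let E , E≥0 , E~D , red = reduced-representative l
          EP≡0 = 0≤i<1⇒i≡0 (E≥0 P) λ 1≤EP →
                   ∅ (LinSysNonempty-resp-~ {_⊖_ G E (δ P)} (~-⊖ {E} {D} (δ P) E~D)
                        (effective⇒LinSysNonempty (-δ-nonNeg E P E≥0 1≤EP)))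
          Q , adjPQ , EQ≡0 = reduced-has-empty-neighbour E E≥0 red
      in Q , adjPQ , λ lQ → reduced-empty-at-neighbour E Q red EP≡0 adjPQ EQ≡0
           (LinSysNonempty-resp-~ {_⊖_ G D (δ Q)} (~-⊖ {D} {E} (δ Q) (~-sym {E} {D} E~D)) lQ)

    Obstruction : Divisor G → ℕ → (Divisor G → Set) → Divisor G → Set
    Obstruction D k Φ E = Effective G E × deg G E ≡ + k × Φ E × ¬ LinSysNonempty G (_⊖_ G D E)

    obstruction? : ∀ D k (Φ : Divisor G → Set) → (∀ {E E′} → E ≗ E′ → Φ E → Φ E′) →
                   (∀ E → Dec (Φ E)) → Dec (∃ (Obstruction D k Φ))
    obstruction? D k Φ Φ-resp Φ? = map′ decode encode
      (Vec-searchable FP.any? n (λ v → Φ? (fromVec v) ×-dec (deg G (fromVec v) ℤ.≟ + k)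
                                       ×-dec ¬? (linSysNonempty? (_⊖_ G D (fromVec v)))))
      where
      Coded : Vec (Fin (suc k)) n → Set
      Coded v = Φ (fromVec v) × deg G (fromVec v) ≡ + k × ¬ LinSysNonempty G (_⊖_ G D (fromVec v))
      decode : ∃ Coded → ∃ (Obstruction D k Φ)
      decode (v , Φv , degv , ∅) = fromVec v , (λ _ → +≤+ z≤n) , degv , Φv , ∅
      encode : ∃ (Obstruction D k Φ) → ∃ Coded
      encode (E , E≥0 , degE , ΦE , ∅) = v , Φ-resp (sym ∘ v≗E) ΦE , trans (∑-cong v≗E) degE ,
                                         ∅ ∘ LinSysNonempty-resp-≗ (λ Q → cong (_-_ (D Q)) (v≗E Q))
        where
        v : Vec (Fin (suc k)) n
        v = proj₁ (effective-fromVec E E≥0 degE)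
        v≗E : fromVec v ≗ E
        v≗E = proj₂ (effective-fromVec E E≥0 degE)

    rankAtLeast? : ∀ D k → Dec (RankAtLeast G D k)
    rankAtLeast? D k = map′ no-obstruction⇒rank rank⇒no-obstruction
                            (¬? (obstruction? D k (λ _ → ⊤) (λ _ _ → tt) (λ _ → yes tt)))
      where
      no-obstruction⇒rank : ¬ ∃ (Obstruction D k (λ _ → ⊤)) → RankAtLeast G D k
      no-obstruction⇒rank ∄ E E≥0 degE =
        decidable-stable (linSysNonempty? (_⊖_ G D E)) (λ ∅ → ∄ (E , E≥0 , degE , tt , ∅))
      rank⇒no-obstruction : RankAtLeast G D k → ¬ ∃ (Obstruction D k (λ _ → ⊤))
      rank⇒no-obstruction r≥k (E , E≥0 , degE , _ , ∅) = ∅ (r≥k E E≥0 degE)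

    rank≥0 : ∀ D → LinSysNonempty G D → RankAtLeast G D 0
    rank≥0 D l E E≥0 degE≡0 = LinSysNonempty-resp-≗ D≗D-E l
      where
      D≗D-E : ∀ Q → D Q ≡ D Q - E Q
      D≗D-E Q = sym (trans (cong (_-_ (D Q)) EQ≡0) (ℤP.+-identityʳ (D Q)))
        where
        EQ≡0 : E Q ≡ + 0
        EQ≡0 = ℤP.≤-antisym (subst (E Q ≤_) degE≡0 (term≤∑ E E≥0 Q)) (E≥0 Q)

    rank≤deg : ∀ D k → deg G D < + k → ¬ RankAtLeast G D k
    rank≤deg D k deg<k r≥k = ℤP.<⇒≱ deg[D-kP]<0 (LinSysNonempty⇒deg≥0 (_⊖_ G D kP) (r≥k kP kP≥0 deg-kP))
      where
      kP : Divisor G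
      kP Q = + k * δ P Q
      kP≥0 : Effective G kP
      kP≥0 Q = subst (_≤ kP Q) (ℤP.*-zeroʳ (+ k)) (ℤP.*-monoˡ-≤-nonNeg (+ k) (δ-nonNeg P Q))
      deg-kP : deg G kP ≡ + k
      deg-kP = trans (sym (*-distribˡ-∑ (+ k) (δ P)))
                     (trans (cong (+ k *_) (∑-δ P)) (ℤP.*-identityʳ (+ k)))
      deg[D-kP]<0 : deg G (_⊖_ G D kP) < + 0
      deg[D-kP]<0 = subst (_< + 0) (sym (trans (∑-distrib-- D kP) (cong (_-_ (deg G D)) deg-kP)))
                      (ℤP.<-≤-trans (ℤP.+-monoˡ-< (- + k) deg<k) (ℤP.≤-reflexive (ℤP.+-inverseʳ (+ k))))

    rank-exists : ∀ D → LinSysNonempty G D →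
                  ∃ λ k → RankAtLeast G D k × (∀ k′ → k ℕ.< k′ → ¬ RankAtLeast G D k′)
    rank-exists D l = maximal-witness (rankAtLeast? D) (rank≥0 D l) ∣ deg G D ∣ λ k ∣deg∣<k →
      rank≤deg D k (subst (_< + k) (ℤP.0≤i⇒+∣i∣≡i (LinSysNonempty⇒deg≥0 D l)) (ℤ.+<+ ∣deg∣<k))

    rank-step : ∀ D k → RankAtLeast G D k →
                (∀ E → Effective G E → deg G E ≡ + suc k → E P ≡ + 0 → LinSysNonempty G (_⊖_ G D E)) →
                RankAtLeast G D (suc k)
    rank-step D k r≥k P-free E E≥0 degE = chips-at-P ∣ E P ∣ E E≥0 degE (sym (ℤP.0≤i⇒+∣i∣≡i (E≥0 P)))
      where
      chips-at-P : ∀ m E → Effective G E → deg G E ≡ + suc k → E P ≡ + m → LinSysNonempty G (_⊖_ G D E)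
      chips-at-P zero    E E≥0 degE EP≡0   = P-free E E≥0 degE EP≡0
      chips-at-P (suc m) E E≥0 degE EP≡1+m = decidable-stable (linSysNonempty? (_⊖_ G D E)) λ ∅ →
        let Q , adjPQ , ∅Q = neighbour-obstruction D′ (r≥k F F≥0 degF)
                               (∅ ∘ LinSysNonempty-resp-≗ (λ R → sub-sub (D R) (E R) (δ P R)))
        in ∅Q (LinSysNonempty-resp-≗ (λ R → sub-add (D R) (F R) (δ Q R))
                 (chips-at-P m (E′ Q) (E′≥0 Q) (degE′ Q) (E′P≡m Q (adj⇒≢ adjPQ))))
        where
        F : Divisor G
        F = _⊖_ G E (δ P)
        F≥0 : Effective G F
        F≥0 = -δ-nonNeg E P E≥0 (subst (+ 1 ≤_) (sym EP≡1+m) (+≤+ (s≤s z≤n)))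
        degF : deg G F ≡ + k
        degF = trans (∑-distrib-- E (δ P)) (cong₂ _-_ degE (∑-δ P))
        D′ : Divisor G
        D′ = _⊖_ G D F
        E′ : Fin n → Divisor G
        E′ Q R = F R + δ Q R
        E′≥0 : ∀ Q → Effective G (E′ Q)
        E′≥0 Q R = ℤP.+-mono-≤ (F≥0 R) (δ-nonNeg Q R)
        degE′ : ∀ Q → deg G (E′ Q) ≡ + suc k
        degE′ Q = trans (∑-distrib-+ F (δ Q)) (trans (cong₂ _+_ degF (∑-δ Q)) (cong +_ (ℕP.+-comm k 1)))
        E′P≡m : ∀ Q → ¬ P ≡ Q → E′ Q P ≡ + m
        E′P≡m Q P≢Q = trans (cong₂ _+_ (cong₂ _-_ EP≡1+m (δ-self P)) (δ-≢ Q P P≢Q))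
                            (ℤP.+-identityʳ (+ m))
        sub-sub : ∀ d e p → d - (e - p) - p ≡ d - e
        sub-sub = solve-∀
        sub-add : ∀ d f q → d - (f + q) ≡ d - f - q
        sub-add = solve-∀

    P-free-obstruction : ∀ D k → RankAtLeast G D k → ¬ RankAtLeast G D (suc k) →
                         ∃ (Obstruction D (suc k) (λ E → E P ≡ + 0))
    P-free-obstruction D k r≥k r≱1+k = decidable-stable P-free-obstruction? λ ∄ →
      r≱1+k (rank-step D k r≥k λ E E≥0 degE EP≡0 →
        decidable-stable (linSysNonempty? (_⊖_ G D E)) (λ ∅ → ∄ (E , E≥0 , degE , EP≡0 , ∅)))
      where
      P-free-obstruction? : Dec (∃ (Obstruction D (suc k) (λ E → E P ≡ + 0)))
      P-free-obstruction? = obstruction? D (suc k) (λ E → E P ≡ + 0) (λ E≗E′ → trans (sym (E≗E′ P)))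
                                         (λ E → E P ℤ.≟ + 0)

lemma3p3 : (G : SimpleGraph) (D : Divisor G) (P : Fin (SimpleGraph.n G)) →
    ∃ λ (E : Divisor G) → InProof G D E × E P ≡ + 0
lemma3p3 G D P = by-cases (linSysNonempty? G P D)
  where
  by-cases : Dec (LinSysNonempty G D) → ∃ λ (E : Divisor G) → InProof G D E × E P ≡ + 0
  by-cases (no ∅) = (λ _ → + 0) ,
    (-[1+ 0 ] , inj₁ (refl , ∅) , (λ _ → +≤+ z≤n) , ∑-zero {SimpleGraph.n G} (λ _ → refl) ,
     ∅ ∘ LinSysNonempty-resp-≗ G (λ Q → ℤP.+-identityʳ (D Q))) , refl
  by-cases (yes l) =
    let k , r≥k , r≯k = rank-exists G P D l
        E , E≥0 , degE , EP≡0 , ∅ = P-free-obstruction G P D k r≥k (r≯k (suc k) ℕP.≤-refl)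
    in E , (+ k , inj₂ (l , k , refl , r≥k , r≯k) , E≥0 , trans degE (cong +_ (ℕP.+-comm 1 k)) , ∅) ,
       EP≡0
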